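{- Let $f:\mathbb{Z} \rightarrow \mathbb{N}_0\cup\{\infty\}$ be a function such that $f^{ -1}(0)$ is finite, and let $\Delta$ denote the cardinality of $f^{ -1}(0)$. Then there exists a sequence $U = \{u_k\}_{k=1}^{\infty}$ of integers such that for every $n \in \mathbb{Z}$, \[ f(n) = \#\{ k\geq 1 : u_k = n \}, \] and for every positive integer $k$, \[ |u_k| \leq \left[\frac{k+\Delta}{2}\right]. \]
   Context: $\mathbb{N}_0$ denotes the nonnegative integers, and $[x]$ denotes the integer part of a real number $x$. -}

module Defs where

open import Data.Nat using (ℕ; zero; suc; _+_; _≤_)
open import Data.Integer using (ℤ)
import Data.Integer.Properties as ℤP
open import Data.Product using (∃)
open import Relation.Nullary using (yes; no)

data ℕ∞ : Set where
  fin : ℕ → ℕ∞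
  ∞   : ℕ∞

-- count u n N = #{ j < N : u j ≡ n }
-- (a sequence u₁, u₂, … is represented by u : ℕ → ℤ with u j = u_{j+1})
count : (ℕ → ℤ) → ℤ → ℕ → ℕ
count u n zero = 0
count u n (suc N) with u N ℤP.≟ n
... | yes _ = suc (count u n N)
... | no  _ = count u n N

HasMultiplicity : (ℕ → ℤ) → ℤ → ℕ∞ → Set
HasMultiplicity u n (fin m) = ∃ λ N → ∀ N′ → N ≤ N′ → count u n N′ ≡ m
  where open import Relation.Binary.PropositionalEquality using (_≡_)
HasMultiplicity u n ∞ = ∀ M → ∃ λ N → M ≤ count u n N

{-# OPTIONS --safe #-}
module Submission where

open import Defs
open import Data.Nat using (ℕ; zero; suc; _+_; _*_; _∸_; _⊓_; _≤_; _<_; _≤′_; ≤′-refl; ≤′-step; _/_; _<?_; z≤n; s≤s; z<s)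
open import Data.Nat.Properties
open import Data.Nat.DivMod using (/-monoˡ-≤; m*n/n≡m)
open import Data.Nat.Tactic.RingSolver using (solve-∀)
open import Data.Integer using (ℤ; ∣_∣; +_; -[1+_])
import Data.Integer.Properties as ℤP
open import Data.List using (List; []; _∷_; [_]; _++_; length; filter; applyUpTo)
open import Data.List.Properties using (length-++; filter-++; filter-accept; filter-reject; filter-none; filter-notAll; applyUpTo-∷ʳ; ++-assoc; ++-identityʳ)
open import Data.List.Membership.Propositional using (_∈_; _∉_)
open import Data.List.Membership.Propositional.Properties using (∈-filter⁺; ∈-filter⁻; ∈-applyUpTo⁺; ∈-applyUpTo⁻; ∈-++⁻; ∈-length)
open import Data.List.Membership.DecPropositional ℤP._≟_ using (_∈?_)
open import Data.List.Relation.Binary.Subset.Propositional using (_⊆_)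
open import Data.List.Relation.Unary.All as All using (All; []; _∷_)
open import Data.List.Relation.Unary.All.Properties using (¬Any⇒All¬; All¬⇒¬Any)
open import Data.List.Relation.Unary.Any as Any using (here; there)
open import Data.List.Relation.Unary.Unique.Propositional using (Unique; []; _∷_)
open import Data.List.Relation.Unary.Unique.Propositional.Properties as Unique using (applyUpTo⁺₁)
open import Data.Product using (∃; _×_; _,_; proj₁; proj₂)
open import Data.Sum using (inj₁; inj₂)
open import Data.Unit using (⊤; tt)
open import Function using (_∘_)
open import Function.Bundles using (_⇔_; Equivalence)
open import Relation.Binary.Definitions using (DecidableEquality)
open import Relation.Binary.PropositionalEquality using (_≡_; _≢_; refl; sym; trans; cong; cong₂; subst; ≢-sym; module ≡-Reasoning)
open import Relation.Nullary using (¬_; Dec; yes; no; contradiction; ¬?)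
open import Relation.Unary using (Pred; Decidable)

-- Enumerate ℤ as 0, 1, -1, 2, -2, …, so that the integer of index i has absolute value at most
-- (i + 1)/2.  The sequence is the concatenation of blocks B₀ B₁ B₂ …, where B_t lists the integers n
-- of index at most t with t - index n < f n.  Thus n occurs once in each of the f n blocks starting
-- at B_(index n), and nowhere else.  The integer of index t lies in B_t unless it is a zero of f, so
-- the first T blocks contain at least T - Δ terms.  Hence term j already lies in the first j + 1 + Δ
-- blocks, whose entries all have index below j + 1 + Δ, i.e. absolute value at most (j + 1 + Δ)/2.

module Counting {a} {A : Set a} (_≟_ : DecidableEquality A) where

  occurrences : A → List A → ℕ
  occurrences x xs = length (filter (_≟ x) xs)

  occurrences-++ : ∀ {x} xs ys → occurrences x (xs ++ ys) ≡ occurrences x xs + occurrences x ys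
  occurrences-++ {x} xs ys = trans (cong length (filter-++ (_≟ x) xs ys)) (length-++ (filter (_≟ x) xs))

  occurrences-∉ : ∀ {x xs} → x ∉ xs → occurrences x xs ≡ 0
  occurrences-∉ {x} {xs} x∉xs = cong length (filter-none (_≟ x) (All.map ≢-sym (¬Any⇒All¬ xs x∉xs)))

  occurrences-unique-∈ : ∀ {x xs} → Unique xs → x ∈ xs → occurrences x xs ≡ 1
  occurrences-unique-∈ {x} (x≢ys ∷ _) (here refl) =
    trans (cong length (filter-accept (_≟ x) refl)) (cong suc (occurrences-∉ (All¬⇒¬Any x≢ys)))
  occurrences-unique-∈ {x} (y≢ys ∷ !ys) (there x∈ys) =
    trans (cong length (filter-reject (_≟ x) (All.lookup y≢ys x∈ys))) (occurrences-unique-∈ !ys x∈ys)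

  module _ {p} {P : Pred A p} (P? : Decidable P) where

    occurrences-filter-accept : ∀ {x} → P x → ∀ xs → occurrences x (filter P? xs) ≡ occurrences x xs
    occurrences-filter-accept Px [] = refl
    occurrences-filter-accept {x} Px (y ∷ ys) with P? y
    ... | yes _ with y ≟ x
    ...   | yes _ = cong suc (occurrences-filter-accept Px ys)
    ...   | no _  = occurrences-filter-accept Px ys
    occurrences-filter-accept {x} Px (y ∷ ys) | no ¬Py with y ≟ x
    ...   | yes refl = contradiction Px ¬Py
    ...   | no _     = occurrences-filter-accept Px ys

    occurrences-filter-reject : ∀ {x} → ¬ P x → ∀ xs → occurrences x (filter P? xs) ≡ 0
    occurrences-filter-reject ¬Px xs =
      occurrences-∉ λ x∈ → ¬Px (proj₂ (∈-filter⁻ P? {xs = xs} x∈))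

  unique-⊆⇒length≤ : ∀ {xs ys} → Unique xs → xs ⊆ ys → length xs ≤ length ys
  unique-⊆⇒length≤ [] _ = z≤n
  unique-⊆⇒length≤ {x ∷ xs} {ys} (x≢xs ∷ !xs) xs⊆ys = begin-strict
    length xs               ≤⟨ unique-⊆⇒length≤ !xs xs⊆ys-x ⟩
    length (filter ≢x? ys)  <⟨ filter-notAll ≢x? ys (Any.map (λ x≡y y≢x → y≢x (sym x≡y)) x∈ys) ⟩
    length ys               ∎
    where
    open ≤-Reasoning
    ≢x? : Decidable (λ y → ¬ y ≡ x)
    ≢x? y = ¬? (y ≟ x)
    x∈ys : x ∈ ys
    x∈ys = xs⊆ys (here refl)
    xs⊆ys-x : xs ⊆ filter ≢x? ys
    xs⊆ys-x y∈xs = ∈-filter⁺ ≢x? (xs⊆ys (there y∈xs)) (≢-sym (All.lookup x≢xs y∈xs))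

open Counting ℤP._≟_

lookupOr : ∀ {a} {A : Set a} → A → List A → ℕ → A
lookupOr d []       _       = d
lookupOr d (x ∷ xs) zero    = x
lookupOr d (x ∷ xs) (suc j) = lookupOr d xs j

module _ {a} {A : Set a} {d : A} where

  lookupOr-++ˡ : ∀ xs {ys j} → j < length xs → lookupOr d (xs ++ ys) j ≡ lookupOr d xs j
  lookupOr-++ˡ (x ∷ xs) {j = zero}  _         = refl
  lookupOr-++ˡ (x ∷ xs) {j = suc j} (s≤s j<) = lookupOr-++ˡ xs j<

  lookupOr-∈ : ∀ xs {j} → j < length xs → lookupOr d xs j ∈ xs
  lookupOr-∈ (x ∷ xs) {zero}  _         = here refl
  lookupOr-∈ (x ∷ xs) {suc j} (s≤s j<) = there (lookupOr-∈ xs j<)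

  applyUpTo-lookupOr : ∀ (u : ℕ → A) xs → (∀ {j} → j < length xs → u j ≡ lookupOr d xs j) →
                       applyUpTo u (length xs) ≡ xs
  applyUpTo-lookupOr u []       _     = refl
  applyUpTo-lookupOr u (x ∷ xs) agree =
    cong₂ _∷_ (agree z<s) (applyUpTo-lookupOr (u ∘ suc) xs (agree ∘ s≤s))

module Concatenation {a} {A : Set a} (d : A) (block : ℕ → List A) where

  prefix : ℕ → List A
  prefix zero    = []
  prefix (suc T) = prefix T ++ block T

  prefix-extends : ∀ {S T} → S ≤′ T → ∃ λ R → prefix T ≡ prefix S ++ R
  prefix-extends ≤′-refl = [] , sym (++-identityʳ _)
  prefix-extends {S} (≤′-step {T} S≤′T) with R , eq ← prefix-extends S≤′T =
    R ++ block T , trans (cong (_++ block T) eq) (++-assoc (prefix S) R (block T))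

  lookupOr-prefix : ∀ {S T j} → S ≤ T → j < length (prefix S) →
                    lookupOr d (prefix T) j ≡ lookupOr d (prefix S) j
  lookupOr-prefix {S} {j = j} S≤T j< with R , eq ← prefix-extends (≤⇒≤′ S≤T) =
    trans (cong (λ xs → lookupOr d xs j) eq) (lookupOr-++ˡ (prefix S) j<)

  module _ (stage : ℕ → ℕ) (reach : ∀ j → j < length (prefix (stage j))) where

    limit : ℕ → A
    limit j = lookupOr d (prefix (stage j)) j

    limit-lookupOr : ∀ {T j} → j < length (prefix T) → limit j ≡ lookupOr d (prefix T) j
    limit-lookupOr {T} {j} j< with ≤-total (stage j) T
    ... | inj₁ stage≤T = sym (lookupOr-prefix stage≤T (reach j))
    ... | inj₂ T≤stage = lookupOr-prefix T≤stage j<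

    applyUpTo-limit : ∀ T → applyUpTo limit (length (prefix T)) ≡ prefix T
    applyUpTo-limit T = applyUpTo-lookupOr {d = d} limit (prefix T) (limit-lookupOr {T})

    limit-∈ : ∀ j → limit j ∈ prefix (stage j)
    limit-∈ j = lookupOr-∈ (prefix (stage j)) (reach j)

module _ (u : ℕ → ℤ) (n : ℤ) where

  count-suc : ∀ N → count u n (suc N) ≡ occurrences n [ u N ] + count u n N
  count-suc N with u N ℤP.≟ n
  ... | yes _ = refl
  ... | no _  = refl

  count-applyUpTo : ∀ N → count u n N ≡ occurrences n (applyUpTo u N)
  count-applyUpTo zero    = refl
  count-applyUpTo (suc N) = begin
    count u n (suc N)                                      ≡⟨ count-suc N ⟩
    occurrences n [ u N ] + count u n N                    ≡⟨ +-comm (occurrences n [ u N ]) _ ⟩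
    count u n N + occurrences n [ u N ]                    ≡⟨ cong (_+ occurrences n [ u N ]) (count-applyUpTo N) ⟩
    occurrences n (applyUpTo u N) + occurrences n [ u N ]  ≡⟨ occurrences-++ (applyUpTo u N) [ u N ] ⟨
    occurrences n (applyUpTo u N ++ [ u N ])               ≡⟨ cong (occurrences n) (applyUpTo-∷ʳ u N) ⟩
    occurrences n (applyUpTo u (suc N))                    ∎
    where open ≡-Reasoning

  count-mono : ∀ {M N} → M ≤ N → count u n M ≤ count u n N
  count-mono = mono ∘ ≤⇒≤′
    where
    mono : ∀ {M N} → M ≤′ N → count u n M ≤ count u n N
    mono ≤′-refl            = ≤-refl
    mono (≤′-step {N} M≤′N) =
      ≤-trans (mono M≤′N) (≤-trans (m≤n+m _ _) (≤-reflexive (sym (count-suc N))))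

infix  4 _<∞_ _<∞?_
infixl 7 _⊓∞_

_<∞_ : ℕ → ℕ∞ → Set
k <∞ fin m = k < m
k <∞ ∞     = ⊤

_<∞?_ : ∀ k x → Dec (k <∞ x)
k <∞? fin m = k <? m
k <∞? ∞     = yes tt

_⊓∞_ : ℕ → ℕ∞ → ℕ
k ⊓∞ fin m = k ⊓ m
k ⊓∞ ∞     = k

≢0⇒0<∞ : ∀ {x} → x ≢ fin 0 → 0 <∞ x
≢0⇒0<∞ {fin zero}    x≢0 = contradiction refl x≢0
≢0⇒0<∞ {fin (suc m)} _   = z<s
≢0⇒0<∞ {∞}           _   = tt

⊓∞-zeroˡ : ∀ x → 0 ⊓∞ x ≡ 0
⊓∞-zeroˡ (fin m) = refl
⊓∞-zeroˡ ∞       = refl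

⊓∞-suc-< : ∀ {k} x → k <∞ x → suc k ⊓∞ x ≡ suc (k ⊓∞ x)
⊓∞-suc-< (fin m) k<m = trans (m≤n⇒m⊓n≡m k<m) (cong suc (sym (m≤n⇒m⊓n≡m (<⇒≤ k<m))))
⊓∞-suc-< ∞       _   = refl

⊓∞-suc-≮ : ∀ {k} x → ¬ k <∞ x → suc k ⊓∞ x ≡ k ⊓∞ x
⊓∞-suc-≮ (fin m) k≮m = trans (m≥n⇒m⊓n≡n (m≤n⇒m≤1+n m≤k)) (sym (m≥n⇒m⊓n≡n m≤k))
  where m≤k = ≮⇒≥ k≮m
⊓∞-suc-≮ ∞       k≮∞ = contradiction tt k≮∞

counts⇒HasMultiplicity : ∀ u n x (pos : ℕ → ℕ) → (∀ k → count u n (pos k) ≡ k ⊓∞ x) →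
                         (∀ M → ∃ λ k → M ≤ pos k) → HasMultiplicity u n x
counts⇒HasMultiplicity u n (fin m) pos count-pos unbounded =
  pos m , λ N pos≤N → ≤-antisym (upper N) (lower pos≤N)
  where
  open ≤-Reasoning
  lower : ∀ {N} → pos m ≤ N → m ≤ count u n N
  lower {N} pos≤N = begin
    m                  ≡⟨ trans (count-pos m) (⊓-idem m) ⟨
    count u n (pos m)  ≤⟨ count-mono u n pos≤N ⟩
    count u n N        ∎
  upper : ∀ N → count u n N ≤ m
  upper N with k , N≤pos ← unbounded N = begin
    count u n N        ≤⟨ count-mono u n N≤pos ⟩
    count u n (pos k)  ≡⟨ count-pos k ⟩
    k ⊓ m              ≤⟨ m⊓n≤n k m ⟩
    m                  ∎
counts⇒HasMultiplicity u n ∞ pos count-pos _ M = pos M , ≤-reflexive (sym (count-pos M))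

next : ℤ → ℤ
next (+ zero)   = + 1
next (+ suc k)  = -[1+ k ]
next -[1+ k ]   = + suc (suc k)

enum : ℕ → ℤ
enum zero    = + 0
enum (suc i) = next (enum i)

index : ℤ → ℕ
index (+ zero)  = 0
index (+ suc k) = suc (2 * k)
index -[1+ k ]  = suc (suc (2 * k))

index-next : ∀ z → index (next z) ≡ suc (index z)
index-next (+ zero)  = refl
index-next (+ suc k) = refl
index-next -[1+ k ]  = cong suc (*-suc 2 k)

index-enum : ∀ i → index (enum i) ≡ i
index-enum zero    = refl
index-enum (suc i) = trans (index-next (enum i)) (cong suc (index-enum i))

enum-odd : ∀ k → enum (suc (2 * k)) ≡ + suc k
enum-odd zero = refl
enum-odd (suc k) = trans (cong (enum ∘ suc) (*-suc 2 k)) (cong (next ∘ next) (enum-odd k))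

enum-index : ∀ n → enum (index n) ≡ n
enum-index (+ zero)  = refl
enum-index (+ suc k) = enum-odd k
enum-index -[1+ k ]  = cong next (enum-odd k)

enum-injective : ∀ {i j} → enum i ≡ enum j → i ≡ j
enum-injective {i} {j} eq = trans (sym (index-enum i)) (trans (cong index eq) (index-enum j))

∣next∘next∣ : ∀ z → ∣ next (next z) ∣ ≡ suc ∣ z ∣
∣next∘next∣ (+ zero)  = refl
∣next∘next∣ (+ suc k) = refl
∣next∘next∣ -[1+ k ]  = refl

∣enum∣*2≤ : ∀ i → ∣ enum i ∣ * 2 ≤ suc i
∣enum∣*2≤ zero          = z≤n
∣enum∣*2≤ (suc zero)    = ≤-refl
∣enum∣*2≤ (suc (suc i)) rewrite ∣next∘next∣ (enum i) = s≤s (s≤s (∣enum∣*2≤ i))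

∣∣≤index/2 : ∀ n {T} → index n < T → ∣ n ∣ ≤ T / 2
∣∣≤index/2 n {T} index<T = begin
  ∣ n ∣                        ≡⟨ m*n/n≡m ∣ n ∣ 2 ⟨
  ∣ n ∣ * 2 / 2                ≤⟨ /-monoˡ-≤ 2 ∣n∣*2≤ ⟩
  suc (index n) / 2            ≤⟨ /-monoˡ-≤ 2 index<T ⟩
  T / 2                        ∎
  where
  open ≤-Reasoning
  ∣n∣*2≤ : ∣ n ∣ * 2 ≤ suc (index n)
  ∣n∣*2≤ = subst (λ z → ∣ z ∣ * 2 ≤ suc (index n)) (enum-index n) (∣enum∣*2≤ (index n))

enum-unique : ∀ T → Unique (applyUpTo enum T)
enum-unique T = applyUpTo⁺₁ enum T (λ i<j _ → <⇒≢ i<j ∘ enum-injective)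

∈-applyUpTo-enum⁺ : ∀ {n T} → index n < T → n ∈ applyUpTo enum T
∈-applyUpTo-enum⁺ {n} index<T = subst (_∈ _) (enum-index n) (∈-applyUpTo⁺ enum index<T)

∈-applyUpTo-enum⁻ : ∀ {n T} → n ∈ applyUpTo enum T → index n < T
∈-applyUpTo-enum⁻ n∈ with i , i<T , refl ← ∈-applyUpTo⁻ enum n∈ = subst (_< _) (sym (index-enum i)) i<T

module Construction (f : ℤ → ℕ∞) (Z : List ℤ) (zero⇒∈Z : ∀ {n} → f n ≡ fin 0 → n ∈ Z) where

  Emitted : ℕ → ℤ → Set
  Emitted t n = t ∸ index n <∞ f n

  emitted? : ∀ t → Decidable (Emitted t)
  emitted? t n = t ∸ index n <∞? f n

  block : ℕ → List ℤ
  block t = filter (emitted? t) (applyUpTo enum (suc t))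

  open Concatenation (+ 0) block

  prefix-index : ∀ {n} T → n ∈ prefix T → index n < T
  prefix-index (suc T) n∈ with ∈-++⁻ (prefix T) n∈
  ... | inj₁ n∈prefix = m≤n⇒m≤1+n (prefix-index T n∈prefix)
  ... | inj₂ n∈block  = ∈-applyUpTo-enum⁻ (proj₁ (∈-filter⁻ (emitted? T) n∈block))

  occurrences-block-emitted : ∀ {n t} → index n ≤ t → Emitted t n → occurrences n (block t) ≡ 1
  occurrences-block-emitted {t = t} index≤t e =
    trans (occurrences-filter-accept (emitted? t) e (applyUpTo enum (suc t)))
          (occurrences-unique-∈ (enum-unique (suc t)) (∈-applyUpTo-enum⁺ (s≤s index≤t)))

  occurrences-block-silent : ∀ {n t} → ¬ Emitted t n → occurrences n (block t) ≡ 0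
  occurrences-block-silent {t = t} ¬e = occurrences-filter-reject (emitted? t) ¬e (applyUpTo enum (suc t))

  occurrences-block-step : ∀ {n t} → index n ≤ t →
                           (t ∸ index n) ⊓∞ f n + occurrences n (block t) ≡ (suc t ∸ index n) ⊓∞ f n
  occurrences-block-step {n} {t} index≤t rewrite +-∸-assoc 1 index≤t with emitted? t n
  ... | yes e = trans (cong (_+_ ((t ∸ index n) ⊓∞ f n)) (occurrences-block-emitted index≤t e))
                      (trans (+-comm _ 1) (sym (⊓∞-suc-< (f n) e)))
  ... | no ¬e = trans (cong (_+_ ((t ∸ index n) ⊓∞ f n)) (occurrences-block-silent ¬e))
                      (trans (+-identityʳ _) (sym (⊓∞-suc-≮ (f n) ¬e)))

  occurrences-prefix : ∀ n T → occurrences n (prefix T) ≡ (T ∸ index n) ⊓∞ f n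
  occurrences-prefix n T with index n <? T
  ... | no index≮T = begin
    occurrences n (prefix T)  ≡⟨ occurrences-∉ (index≮T ∘ prefix-index T) ⟩
    0                         ≡⟨ ⊓∞-zeroˡ (f n) ⟨
    0 ⊓∞ f n                  ≡⟨ cong (_⊓∞ f n) (m≤n⇒m∸n≡0 (≮⇒≥ index≮T)) ⟨
    (T ∸ index n) ⊓∞ f n      ∎
    where open ≡-Reasoning
  occurrences-prefix n (suc T) | yes index<1+T = begin
    occurrences n (prefix T ++ block T)
      ≡⟨ occurrences-++ (prefix T) (block T) ⟩
    occurrences n (prefix T) + occurrences n (block T)
      ≡⟨ cong (_+ occurrences n (block T)) (occurrences-prefix n T) ⟩
    (T ∸ index n) ⊓∞ f n + occurrences n (block T)
      ≡⟨ occurrences-block-step (≤-pred index<1+T) ⟩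
    (suc T ∸ index n) ⊓∞ f n
      ∎
    where open ≡-Reasoning

  zerosBelow : ℕ → List ℤ
  zerosBelow T = filter (_∈? Z) (applyUpTo enum T)

  zerosBelow-suc : ∀ T → zerosBelow (suc T) ≡ zerosBelow T ++ filter (_∈? Z) [ enum T ]
  zerosBelow-suc T = trans (cong (filter (_∈? Z)) (sym (applyUpTo-∷ʳ enum T)))
                           (filter-++ (_∈? Z) (applyUpTo enum T) [ enum T ])

  length-zerosBelow : ∀ T → length (zerosBelow T) ≤ length Z
  length-zerosBelow T = unique-⊆⇒length≤ (Unique.filter⁺ (_∈? Z) (enum-unique T)) zerosBelow⊆Z
    where
    zerosBelow⊆Z : zerosBelow T ⊆ Z
    zerosBelow⊆Z x∈ = proj₂ (∈-filter⁻ (_∈? Z) {xs = applyUpTo enum T} x∈)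

  enum∈block : ∀ t → enum t ∉ Z → enum t ∈ block t
  enum∈block t t∉Z = ∈-filter⁺ (emitted? t) (∈-applyUpTo⁺ enum ≤-refl) emitted
    where
    emitted : Emitted t (enum t)
    emitted = subst (_<∞ f (enum t)) (sym (trans (cong (t ∸_) (index-enum t)) (n∸n≡0 t)))
                    (≢0⇒0<∞ (t∉Z ∘ zero⇒∈Z))

  stage-progress : ∀ t → 1 ≤ length (block t) + length (filter (_∈? Z) [ enum t ])
  stage-progress t with enum t ∈? Z
  ... | yes _  = m≤n+m 1 _
  ... | no t∉Z = ≤-trans (∈-length (enum∈block t t∉Z)) (m≤m+n _ 0)

  length-prefix : ∀ T → T ≤ length (prefix T) + length (zerosBelow T)
  length-prefix zero    = z≤n
  length-prefix (suc T) = begin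
    1 + T              ≤⟨ +-mono-≤ (stage-progress T) (length-prefix T) ⟩
    (b + d) + (a + c)  ≡⟨ rearrange a b c d ⟩
    (a + b) + (c + d)  ≡⟨ cong₂ _+_ (length-++ (prefix T)) length-zerosBelow-suc ⟨
    length (prefix (suc T)) + length (zerosBelow (suc T)) ∎
    where
    open ≤-Reasoning
    a = length (prefix T)
    b = length (block T)
    c = length (zerosBelow T)
    d = length (filter (_∈? Z) [ enum T ])
    rearrange : ∀ a b c d → (b + d) + (a + c) ≡ (a + b) + (c + d)
    rearrange = solve-∀
    length-zerosBelow-suc : length (zerosBelow (suc T)) ≡ c + d
    length-zerosBelow-suc = trans (cong length (zerosBelow-suc T)) (length-++ (zerosBelow T))

  ≤-length-prefix : ∀ {m T} → m + length Z ≤ T → m ≤ length (prefix T)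
  ≤-length-prefix {m} {T} m+Δ≤T = +-cancelʳ-≤ (length Z) m (length (prefix T)) (begin
    m + length Z                               ≤⟨ m+Δ≤T ⟩
    T                                          ≤⟨ length-prefix T ⟩
    length (prefix T) + length (zerosBelow T)  ≤⟨ +-monoʳ-≤ (length (prefix T)) (length-zerosBelow T) ⟩
    length (prefix T) + length Z               ∎)
    where open ≤-Reasoning

  stage : ℕ → ℕ
  stage j = suc j + length Z

  reach : ∀ j → j < length (prefix (stage j))
  reach j = ≤-length-prefix ≤-refl

  sequence : ℕ → ℤ
  sequence = limit stage reach

  count-prefix : ∀ n T → count sequence n (length (prefix T)) ≡ occurrences n (prefix T)
  count-prefix n T = trans (count-applyUpTo sequence n (length (prefix T)))
                           (cong (occurrences n) (applyUpTo-limit stage reach T))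

  sequence-multiplicity : ∀ n → HasMultiplicity sequence n (f n)
  sequence-multiplicity n = counts⇒HasMultiplicity sequence n (f n) pos count-pos unbounded
    where
    pos : ℕ → ℕ
    pos k = length (prefix (index n + k))
    count-pos : ∀ k → count sequence n (pos k) ≡ k ⊓∞ f n
    count-pos k = trans (count-prefix n (index n + k))
                        (trans (occurrences-prefix n (index n + k)) (cong (_⊓∞ f n) (m+n∸m≡n (index n) k)))
    unbounded : ∀ M → ∃ λ k → M ≤ pos k
    unbounded M = M + length Z , ≤-length-prefix (m≤n+m _ (index n))

  ∣sequence∣≤ : ∀ j → ∣ sequence j ∣ ≤ (suc j + length Z) / 2
  ∣sequence∣≤ j = ∣∣≤index/2 (sequence j) (prefix-index (stage j) (limit-∈ stage reach j))

lemma1 : (f : ℤ → ℕ∞) (Z : List ℤ) → Unique Z → (∀ n → (f n ≡ fin 0) ⇔ (n ∈ Z))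
         → ∃ λ (u : ℕ → ℤ) →
             (∀ n → HasMultiplicity u n (f n))
             × (∀ j → ∣ u j ∣ ≤ (suc j + length Z) / 2)
lemma1 f Z _ zeros = sequence , sequence-multiplicity , ∣sequence∣≤
  where open Construction f Z (Equivalence.to (zeros _))
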